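{- Let $D$ be a unique factorization domain and let $a,b$ be elements algebraic over $D$ such that $(a+b)^2$ and $ab$ are coprime elements of $D$. Let $m, n$ be positive integers which are both odd. Then $P_m(a^n,b^n)$ and $(a^n+b^n)/(a+b)$ (which lie in $D$) are coprime in $D$.
   Context: For $m \ge 1$, $P_m(X,Y) = \frac{X^m - Y^m}{X-Y} = \sum_{k=0}^{m-1}X^{m-1-k}Y^k \in \mathbb{Z}[X,Y]$. Coprime means having no common prime divisor in $D$. -}

module Defs where

open import Level using (Level; _⊔_)
open import Algebra.Bundles using (CommutativeRing; RawRing)
import Algebra.Definitions.RawSemiring as RS
open import Algebra.Morphism.Structures using (module RingMorphisms)
open import Data.Nat using (ℕ; _∸_)
open import Data.List using (List; []; _∷_; foldr; map; upTo)
open import Data.List.Relation.Unary.All using (All)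
open import Data.List.Relation.Unary.Any using (Any)
open import Data.List.Relation.Binary.Pointwise using (Pointwise)
open import Data.List.Relation.Binary.Permutation.Propositional using (_↭_)
open import Data.Product using (Σ; ∃; _×_)
open import Data.Sum using (_⊎_)
open import Data.Empty using (⊥)
open import Relation.Nullary using (¬_)

private
  variable
    c ℓ c' ℓ' : Level

module _ (D : CommutativeRing c ℓ) where
  open CommutativeRing D
  open RS (RawRing.rawSemiring rawRing) hiding (_×_)

  prod : List Carrier → Carrier
  prod = foldr _*_ 1#

  Associated : Carrier → Carrier → Set (c ⊔ ℓ)
  Associated x y = Σ Carrier λ u → (u ∣ 1#) × (x ≈ u * y)

  record IsIntegralDomain : Set (c ⊔ ℓ) where
    field
      1≉0        : ¬ (1# ≈ 0#)
      zero-prod  : ∀ x y → x * y ≈ 0# → x ≈ 0# ⊎ y ≈ 0#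

  record IsUFD : Set (c ⊔ ℓ) where
    field
      isIntegralDomain : IsIntegralDomain
      factorization    : ∀ x → ¬ (x ≈ 0#) → ¬ (x ∣ 1#) →
                         Σ (List Carrier) λ ps → All Irreducible ps × (x ≈ prod ps)
      uniqueness       : ∀ ps qs → All Irreducible ps → All Irreducible qs →
                         prod ps ≈ prod qs →
                         Σ (List Carrier) λ qs' → (qs' ↭ qs) × Pointwise Associated ps qs'

  CoprimeElts : Carrier → Carrier → Set (c ⊔ ℓ)
  CoprimeElts x y = ∀ p → Prime p → p ∣ x → p ∣ y → ⊥

module _ (R : CommutativeRing c' ℓ') where
  open CommutativeRing R
  open RS (RawRing.rawSemiring rawRing) hiding (_×_)

  P : ℕ → Carrier → Carrier → Carrier
  P m x y = foldr _+_ 0# (map (λ k → (x ^ (m ∸ 1 ∸ k)) * (y ^ k)) (upTo m))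

  -- (X^n + Y^n)/(X + Y) for odd n, as the polynomial Σ_{k=0}^{n-1} (-1)^k X^{n-1-k} Y^k
  Q : ℕ → Carrier → Carrier → Carrier
  Q n x y = foldr _+_ 0# (map (λ k → ((- 1#) ^ k) * ((x ^ (n ∸ 1 ∸ k)) * (y ^ k))) (upTo n))

module _ (D : CommutativeRing c ℓ) (R : CommutativeRing c' ℓ') where
  private
    module D = CommutativeRing D
    module R = CommutativeRing R

  IsRingMonomorphism : (D.Carrier → R.Carrier) → Set (c ⊔ ℓ ⊔ ℓ')
  IsRingMonomorphism = RingMorphisms.IsRingMonomorphism D.rawRing R.rawRing

  -- evaluation at a ∈ R of a polynomial over D given by its coefficient list
  -- (constant term first)
  evalPoly : (D.Carrier → R.Carrier) → List D.Carrier → R.Carrier → R.Carrier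
  evalPoly ι cs a = foldr (λ d acc → ι d R.+ (a R.* acc)) R.0# cs

  IsAlgebraic : (D.Carrier → R.Carrier) → R.Carrier → Set (c ⊔ ℓ ⊔ ℓ')
  IsAlgebraic ι a = Σ (List D.Carrier) λ cs → Any (λ d → ¬ (d D.≈ D.0#)) cs × (evalPoly ι cs a R.≈ R.0#)

pow : (R : CommutativeRing c' ℓ') → CommutativeRing.Carrier R → ℕ → CommutativeRing.Carrier R
pow R = RS._^_ (RawRing.rawSemiring (CommutativeRing.rawRing R))

{-# OPTIONS --safe #-}

-- P_k(x, y) is the Lucas sequence U_k(x + y, xy). Its odd-index terms obey a recurrence in
-- σ = (x + y)² and π = xy alone, U_{2i+1} = L_i(σ, π), with L_i ≡ (-π)^i mod σ and L_i ≡ σ^i mod π.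
-- Since Q_n(a, b) = P_n(a, -b) and (a + b) Q_n(a, b) = a^n + b^n for odd n, the elements
-- y = L_j(s - 4p, -p) and x = L_i(s y², p^n) of D are sent by ι to Q_n(a, b) and P_m(a^n, b^n).
-- A prime dividing x and y divides s y², hence p^n and p, hence s - 4p and s.

module Submission where

open import Defs
open import Level using (Level)
open import Algebra.Bundles using (CommutativeRing; RawRing)
import Algebra.Definitions.RawSemiring as RawSemiring
open import Algebra.Morphism.Structures using (module RingMorphisms)
open import Algebra.Solver.Ring.AlmostCommutativeRing
  using (fromCommutativeRing; _-Raw-AlmostCommutative⟶_)
open import Data.Empty using (⊥-elim)
open import Data.Integer as ℤ using (ℤ; +_; -[1+_]; _⊖_)
import Data.Integer.Properties as ℤ
open import Data.List using (foldr; applyUpTo)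
open import Data.List.Properties using (map-upTo)
import Data.Maybe as Maybe
open import Data.Nat as ℕ using (ℕ; zero; suc; _∸_; _<_; _%_; _/_)
import Data.Nat.Properties as ℕ
open import Data.Nat.DivMod using (m≡m%n+[m/n]*n)
open import Data.Product using (Σ; _×_; _,_)
open import Data.Sign as Sign using (Sign)
open import Data.Sum using (inj₁; inj₂)
open import Function using (_∘_)
open import Relation.Binary.PropositionalEquality as ≡ using (_≡_)
open import Relation.Nullary.Decidable using (dec⇒maybe)

-- The ring solver needs coefficients with decidable equality; ℤ maps into every commutative ring.
module IntegerCoefficientSolver {c ℓ} (R : CommutativeRing c ℓ) where
  open CommutativeRing R
  open import Algebra.Properties.Ring ring using (-0#≈0#; -1*x≈-x; -‿involutive; -‿+-comm)
  open import Algebra.Properties.CommutativeSemigroup +-commutativeSemigroup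
    using (interchange)
  open import Algebra.Properties.CommutativeSemigroup *-commutativeSemigroup
    using () renaming (interchange to *-interchange)
  open import Algebra.Properties.Semiring.Mult.TCOptimised semiring
    using (1+×; ×-homo-+; ×1-homo-*) renaming (_×_ to _×′_)
  open import Relation.Binary.Reasoning.Setoid setoid

  private
    ⟦_⟧ : ℤ → Carrier
    ⟦ + n ⟧      = n ×′ 1#
    ⟦ -[1+ n ] ⟧ = - (suc n ×′ 1#)

    ⊖-homo : ∀ m n → ⟦ m ⊖ n ⟧ ≈ m ×′ 1# - n ×′ 1#
    ⊖-homo m       zero    = sym (trans (+-congˡ -0#≈0#) (+-identityʳ _))
    ⊖-homo zero    (suc n) = sym (+-identityˡ _)
    ⊖-homo (suc m) (suc n) = begin
      ⟦ suc m ⊖ suc n ⟧                   ≡⟨ ≡.cong ⟦_⟧ (ℤ.[1+m]⊖[1+n]≡m⊖n m n) ⟩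
      ⟦ m ⊖ n ⟧                           ≈⟨ ⊖-homo m n ⟩
      m ×′ 1# - n ×′ 1#                   ≈⟨ +-identityˡ _ ⟨
      0# + (m ×′ 1# - n ×′ 1#)            ≈⟨ +-congʳ (-‿inverseʳ 1#) ⟨
      (1# - 1#) + (m ×′ 1# - n ×′ 1#)     ≈⟨ interchange 1# (- 1#) (m ×′ 1#) (- (n ×′ 1#)) ⟩
      (1# + m ×′ 1#) + (- 1# - n ×′ 1#)   ≈⟨ +-congˡ (-‿+-comm 1# (n ×′ 1#)) ⟩
      (1# + m ×′ 1#) - (1# + n ×′ 1#)     ≈⟨ +-cong (1+× m 1#) (-‿cong (1+× n 1#)) ⟨
      suc m ×′ 1# - suc n ×′ 1#           ∎

    +-homo : ∀ i j → ⟦ i ℤ.+ j ⟧ ≈ ⟦ i ⟧ + ⟦ j ⟧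
    +-homo (+ m)    (+ n)    = ×-homo-+ 1# m n
    +-homo (+ m)    -[1+ n ] = ⊖-homo m (suc n)
    +-homo -[1+ m ] (+ n)    = trans (⊖-homo n (suc m)) (+-comm _ _)
    +-homo -[1+ m ] -[1+ n ] = begin
      - (suc (suc (m ℕ.+ n)) ×′ 1#)       ≡⟨ ≡.cong (λ k → - (suc k ×′ 1#)) (ℕ.+-suc m n) ⟨
      - ((suc m ℕ.+ suc n) ×′ 1#)         ≈⟨ -‿cong (×-homo-+ 1# (suc m) (suc n)) ⟩
      - (suc m ×′ 1# + suc n ×′ 1#)       ≈⟨ -‿+-comm _ _ ⟨
      - (suc m ×′ 1#) + - (suc n ×′ 1#)   ∎

    -‿homo : ∀ i → ⟦ ℤ.- i ⟧ ≈ - ⟦ i ⟧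
    -‿homo -[1+ n ]  = sym (-‿involutive _)
    -‿homo (+ zero)  = sym -0#≈0#
    -‿homo (+ suc n) = refl

    ⟦_⟧ₛ : Sign → Carrier
    ⟦ Sign.+ ⟧ₛ = 1#
    ⟦ Sign.- ⟧ₛ = - 1#

    ◃-homo : ∀ s n → ⟦ s ℤ.◃ n ⟧ ≈ ⟦ s ⟧ₛ * (n ×′ 1#)
    ◃-homo s      zero    = sym (zeroʳ _)
    ◃-homo Sign.+ (suc n) = sym (*-identityˡ _)
    ◃-homo Sign.- (suc n) = sym (-1*x≈-x _)

    ⟦⟧≈sign*abs : ∀ i → ⟦ i ⟧ ≈ ⟦ ℤ.sign i ⟧ₛ * (ℤ.∣ i ∣ ×′ 1#)
    ⟦⟧≈sign*abs i =
      trans (reflexive (≡.cong ⟦_⟧ (≡.sym (ℤ.◃-inverse i)))) (◃-homo (ℤ.sign i) ℤ.∣ i ∣)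

    sign-*-homo : ∀ s t → ⟦ s Sign.* t ⟧ₛ ≈ ⟦ s ⟧ₛ * ⟦ t ⟧ₛ
    sign-*-homo Sign.+ t      = sym (*-identityˡ _)
    sign-*-homo Sign.- Sign.+ = sym (*-identityʳ _)
    sign-*-homo Sign.- Sign.- = sym (trans (-1*x≈-x _) (-‿involutive 1#))

    *-homo : ∀ i j → ⟦ i ℤ.* j ⟧ ≈ ⟦ i ⟧ * ⟦ j ⟧
    *-homo i j = begin
      ⟦ (ℤ.sign i Sign.* ℤ.sign j) ℤ.◃ (ℤ.∣ i ∣ ℕ.* ℤ.∣ j ∣) ⟧
        ≈⟨ ◃-homo (ℤ.sign i Sign.* ℤ.sign j) (ℤ.∣ i ∣ ℕ.* ℤ.∣ j ∣) ⟩
      ⟦ ℤ.sign i Sign.* ℤ.sign j ⟧ₛ * ((ℤ.∣ i ∣ ℕ.* ℤ.∣ j ∣) ×′ 1#)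
        ≈⟨ *-cong (sign-*-homo (ℤ.sign i) (ℤ.sign j)) (×1-homo-* ℤ.∣ i ∣ ℤ.∣ j ∣) ⟩
      (⟦ ℤ.sign i ⟧ₛ * ⟦ ℤ.sign j ⟧ₛ) * ((ℤ.∣ i ∣ ×′ 1#) * (ℤ.∣ j ∣ ×′ 1#))
        ≈⟨ *-interchange _ _ _ _ ⟩
      (⟦ ℤ.sign i ⟧ₛ * (ℤ.∣ i ∣ ×′ 1#)) * (⟦ ℤ.sign j ⟧ₛ * (ℤ.∣ j ∣ ×′ 1#))
        ≈⟨ *-cong (⟦⟧≈sign*abs i) (⟦⟧≈sign*abs j) ⟨
      ⟦ i ⟧ * ⟦ j ⟧ ∎

    ℤ⟶R : ℤ.+-*-rawRing -Raw-AlmostCommutative⟶ fromCommutativeRing R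
    ℤ⟶R = record
      { ⟦_⟧ = ⟦_⟧ ; +-homo = +-homo ; *-homo = *-homo ; -‿homo = -‿homo
      ; 0-homo = refl ; 1-homo = refl }

  open import Algebra.Solver.Ring ℤ.+-*-rawRing (fromCommutativeRing R) ℤ⟶R
    (λ i j → Maybe.map (reflexive ∘ ≡.cong ⟦_⟧) (dec⇒maybe (i ℤ.≟ j)))
    public using (solve; _:=_; _:+_; _:*_; _:-_; :-_; _:^_; con)

module Congruence {c ℓ} (D : CommutativeRing c ℓ) where
  open CommutativeRing D
  open RawSemiring (RawRing.rawSemiring rawRing) using (_∣_; Prime; _^_)
  open import Algebra.Definitions.RawMagma *-rawMagma using (_,_)
  open import Algebra.Properties.Ring ring using (-‿distribˡ-*; -‿involutive)
  open import Algebra.Properties.Magma.Divisibility *-magma using (∣ʳ-respʳ-≈)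
  open import Algebra.Properties.Semiring.Divisibility semiring using (_∣0)
  open IntegerCoefficientSolver D

  ∣-+ : ∀ {q x y} → q ∣ x → q ∣ y → q ∣ x + y
  ∣-+ {q} (a , aq≈x) (b , bq≈y) = a + b , trans (distribʳ q a b) (+-cong aq≈x bq≈y)

  ∣‿- : ∀ {q x} → q ∣ x → q ∣ - x
  ∣‿- {q} (a , aq≈x) = - a , trans (sym (-‿distribˡ-* a q)) (-‿cong aq≈x)

  ∣‿-⁻¹ : ∀ {q x} → q ∣ - x → q ∣ x
  ∣‿-⁻¹ q∣-x = ∣ʳ-respʳ-≈ (-‿involutive _) (∣‿- q∣-x)

  Prime⇒∣^⇒∣ : ∀ {q} → Prime q → ∀ x k → q ∣ x ^ k → q ∣ x
  Prime⇒∣^⇒∣ q-prime x zero    q∣1 = ⊥-elim (Prime.p∤1 q-prime q∣1)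
  Prime⇒∣^⇒∣ q-prime x (suc k) q∣xxᵏ with Prime.split-∣ q-prime q∣xxᵏ
  ... | inj₁ q∣x  = q∣x
  ... | inj₂ q∣xᵏ = Prime⇒∣^⇒∣ q-prime x k q∣xᵏ

  infix 4 _≈_[mod_]
  _≈_[mod_] : Carrier → Carrier → Carrier → Set _
  x ≈ y [mod q ] = q ∣ x - y

  module _ {q : Carrier} where

    ≈⇒≈[mod] : ∀ {x y} → x ≈ y → x ≈ y [mod q ]
    ≈⇒≈[mod] {y = y} x≈y =
      ∣ʳ-respʳ-≈ (sym (trans (+-congʳ x≈y) (-‿inverseʳ y))) (q ∣0)

    ≈[mod]-trans : ∀ {x y z} → x ≈ y [mod q ] → y ≈ z [mod q ] → x ≈ z [mod q ]
    ≈[mod]-trans {x} {y} {z} x≈y y≈z = ∣ʳ-respʳ-≈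
      (solve 3 (λ x y z → (x :- y) :+ (y :- z) := x :- z) refl x y z) (∣-+ x≈y y≈z)

    +-cong[mod] : ∀ {x x′ y y′} → x ≈ x′ [mod q ] → y ≈ y′ [mod q ] →
                  x + y ≈ x′ + y′ [mod q ]
    +-cong[mod] {x} {x′} {y} {y′} x≈x′ y≈y′ = ∣ʳ-respʳ-≈
      (solve 4 (λ x x′ y y′ → (x :- x′) :+ (y :- y′) := (x :+ y) :- (x′ :+ y′))
        refl x x′ y y′)
      (∣-+ x≈x′ y≈y′)

    -‿cong[mod] : ∀ {x x′} → x ≈ x′ [mod q ] → - x ≈ - x′ [mod q ]
    -‿cong[mod] {x} {x′} x≈x′ = ∣ʳ-respʳ-≈
      (solve 2 (λ x x′ → :- (x :- x′) := :- x :- :- x′) refl x x′) (∣‿- x≈x′)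

    *-cong[mod] : ∀ {x x′ y y′} → x ≈ x′ [mod q ] → y ≈ y′ [mod q ] →
                  x * y ≈ x′ * y′ [mod q ]
    *-cong[mod] {x} {x′} {y} {y′} (a , aq≈x-x′) (b , bq≈y-y′) =
      a * y + x′ * b , (begin
        (a * y + x′ * b) * q
          ≈⟨ solve 5 (λ a b q y x′ →
               (a :* y :+ x′ :* b) :* q := (a :* q) :* y :+ x′ :* (b :* q)) refl a b q y x′ ⟩
        (a * q) * y + x′ * (b * q)
          ≈⟨ +-cong (*-congʳ aq≈x-x′) (*-congˡ bq≈y-y′) ⟩
        (x - x′) * y + x′ * (y - y′)
          ≈⟨ solve 4 (λ x x′ y y′ →
               (x :- x′) :* y :+ x′ :* (y :- y′) := x :* y :- x′ :* y′) refl x x′ y y′ ⟩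
        x * y - x′ * y′ ∎)
      where open import Relation.Binary.Reasoning.Setoid setoid

    ∣⇒≈0[mod] : ∀ {x} → q ∣ x → x ≈ 0# [mod q ]
    ∣⇒≈0[mod] {x} = ∣ʳ-respʳ-≈ (solve 1 (λ x → x := x :- con (+ 0)) refl x)

    ≈[mod]∧∣⇒∣ : ∀ {x y} → x ≈ y [mod q ] → q ∣ x → q ∣ y
    ≈[mod]∧∣⇒∣ {x} {y} x≈y q∣x = ∣ʳ-respʳ-≈
      (solve 2 (λ x y → x :- (x :- y) := y) refl x y) (∣-+ q∣x (∣‿- x≈y))

module LucasSequences {c ℓ} (R : CommutativeRing c ℓ) where
  open CommutativeRing R
  open RawSemiring (RawRing.rawSemiring rawRing) using (_^_)
  open IntegerCoefficientSolver R

  lucasU : Carrier → Carrier → ℕ → Carrier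
  lucasU t p zero          = 0#
  lucasU t p (suc zero)    = 1#
  lucasU t p (suc (suc k)) = t * lucasU t p (suc k) - p * lucasU t p k

  -- The odd-index terms of lucasU t p as a sequence in σ = t ^ 2 and π = p (lucasU-odd).
  lucasOdd : Carrier → Carrier → ℕ → Carrier
  lucasOdd σ π zero          = 1#
  lucasOdd σ π (suc zero)    = σ - π
  lucasOdd σ π (suc (suc i)) = (σ - (π + π)) * lucasOdd σ π (suc i) - (π * π) * lucasOdd σ π i

  lucasU-+4 : ∀ t p k → lucasU t p (4 ℕ.+ k) ≈
              (t ^ 2 - (p + p)) * lucasU t p (2 ℕ.+ k) - (p * p) * lucasU t p k
  lucasU-+4 t p k = solve 4 (λ t p u₁ u₀ →
      t :* (t :* (t :* u₁ :- p :* u₀) :- p :* u₁) :- p :* (t :* u₁ :- p :* u₀)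
    := (t :^ 2 :- (p :+ p)) :* (t :* u₁ :- p :* u₀) :- (p :* p) :* u₀)
    refl t p (lucasU t p (suc k)) (lucasU t p k)

  lucasU-odd : ∀ t p i → lucasU t p (suc (i ℕ.* 2)) ≈ lucasOdd (t ^ 2) p i
  lucasU-odd t p zero          = refl
  lucasU-odd t p (suc zero)    = solve 2 (λ t p →
      t :* (t :* con (+ 1) :- p :* con (+ 0)) :- p :* con (+ 1) := t :^ 2 :- p) refl t p
  lucasU-odd t p (suc (suc i)) = trans (lucasU-+4 t p (suc (i ℕ.* 2)))
    (+-cong (*-congˡ (lucasU-odd t p (suc i))) (-‿cong (*-congˡ (lucasU-odd t p i))))

  lucasOdd-0-π : ∀ π i → lucasOdd 0# π i ≈ (- π) ^ i
  lucasOdd-0-π π zero          = refl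
  lucasOdd-0-π π (suc zero)    =
    solve 1 (λ π → con (+ 0) :- π := :- π :* con (+ 1)) refl π
  lucasOdd-0-π π (suc (suc i)) = begin
    (0# - (π + π)) * lucasOdd 0# π (suc i) - (π * π) * lucasOdd 0# π i
      ≈⟨ +-cong (*-congˡ (lucasOdd-0-π π (suc i))) (-‿cong (*-congˡ (lucasOdd-0-π π i))) ⟩
    (0# - (π + π)) * (- π * (- π) ^ i) - (π * π) * (- π) ^ i
      ≈⟨ solve 2 (λ π u →
           (con (+ 0) :- (π :+ π)) :* (:- π :* u) :- (π :* π) :* u := :- π :* (:- π :* u))
           refl π ((- π) ^ i) ⟩
    (- π) ^ suc (suc i) ∎
    where open import Relation.Binary.Reasoning.Setoid setoid

  lucasOdd-σ-0 : ∀ σ i → lucasOdd σ 0# i ≈ σ ^ i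
  lucasOdd-σ-0 σ zero          = refl
  lucasOdd-σ-0 σ (suc zero)    = solve 1 (λ σ → σ :- con (+ 0) := σ :* con (+ 1)) refl σ
  lucasOdd-σ-0 σ (suc (suc i)) = begin
    (σ - (0# + 0#)) * lucasOdd σ 0# (suc i) - (0# * 0#) * lucasOdd σ 0# i
      ≈⟨ +-cong (*-congˡ (lucasOdd-σ-0 σ (suc i))) (-‿cong (*-congˡ (lucasOdd-σ-0 σ i))) ⟩
    (σ - (0# + 0#)) * (σ * σ ^ i) - (0# * 0#) * σ ^ i
      ≈⟨ solve 2 (λ σ u →
           (σ :- (con (+ 0) :+ con (+ 0))) :* (σ :* u) :- (con (+ 0) :* con (+ 0)) :* u
           := σ :* (σ :* u))
           refl σ (σ ^ i) ⟩
    σ ^ suc (suc i) ∎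
    where open import Relation.Binary.Reasoning.Setoid setoid

module LucasOddDivisibility {c ℓ} (D : CommutativeRing c ℓ) where
  open CommutativeRing D
  open RawSemiring (RawRing.rawSemiring rawRing) using (_∣_; Prime)
  open Congruence D
  open LucasSequences D

  lucasOdd-cong[mod] : ∀ {q σ σ′ π π′} → σ ≈ σ′ [mod q ] → π ≈ π′ [mod q ] →
                       ∀ i → lucasOdd σ π i ≈ lucasOdd σ′ π′ i [mod q ]
  lucasOdd-cong[mod] _    _    zero          = ≈⇒≈[mod] refl
  lucasOdd-cong[mod] σ≈σ′ π≈π′ (suc zero)    = +-cong[mod] σ≈σ′ (-‿cong[mod] π≈π′)
  lucasOdd-cong[mod] σ≈σ′ π≈π′ (suc (suc i)) = +-cong[mod]
    (*-cong[mod] (+-cong[mod] σ≈σ′ (-‿cong[mod] (+-cong[mod] π≈π′ π≈π′)))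
                 (lucasOdd-cong[mod] σ≈σ′ π≈π′ (suc i)))
    (-‿cong[mod] (*-cong[mod] (*-cong[mod] π≈π′ π≈π′) (lucasOdd-cong[mod] σ≈σ′ π≈π′ i)))

  -- Modulo q the sequence is (- π) ^ i when q ∣ σ, and σ ^ i when q ∣ π.
  Prime∧∣σ∧∣lucasOdd⇒∣π : ∀ {q σ π} → Prime q → q ∣ σ → ∀ i → q ∣ lucasOdd σ π i → q ∣ π
  Prime∧∣σ∧∣lucasOdd⇒∣π {π = π} q-prime q∣σ i q∣L = ∣‿-⁻¹ (Prime⇒∣^⇒∣ q-prime (- π) i
    (≈[mod]∧∣⇒∣ (≈[mod]-trans (lucasOdd-cong[mod] (∣⇒≈0[mod] q∣σ) (≈⇒≈[mod] refl) i)
                              (≈⇒≈[mod] (lucasOdd-0-π π i)))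
                q∣L))

  Prime∧∣π∧∣lucasOdd⇒∣σ : ∀ {q σ π} → Prime q → q ∣ π → ∀ i → q ∣ lucasOdd σ π i → q ∣ σ
  Prime∧∣π∧∣lucasOdd⇒∣σ {σ = σ} q-prime q∣π i q∣L = Prime⇒∣^⇒∣ q-prime σ i
    (≈[mod]∧∣⇒∣ (≈[mod]-trans (lucasOdd-cong[mod] (≈⇒≈[mod] refl) (∣⇒≈0[mod] q∣π) i)
                              (≈⇒≈[mod] (lucasOdd-σ-0 σ i)))
                q∣L)

module GeometricSums {c ℓ} (R : CommutativeRing c ℓ) where
  open CommutativeRing R
  open RawSemiring (RawRing.rawSemiring rawRing) using (_^_)
  open import Algebra.Properties.Ring ring using (-1*x≈-x; -‿involutive)
  open import Algebra.Properties.Semiring.Exp semiring using (^-congˡ)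
  open import Algebra.Properties.CommutativeSemiring.Exp commutativeSemiring using (^-distrib-*)
  open import Relation.Binary.Reasoning.Setoid setoid
  open IntegerCoefficientSolver R
  open LucasSequences R

  ∑ : ℕ → (ℕ → Carrier) → Carrier
  ∑ n f = foldr _+_ 0# (applyUpTo f n)

  ∑-cong : ∀ n {f g} → (∀ k → f k ≈ g k) → ∑ n f ≈ ∑ n g
  ∑-cong zero    f≈g = refl
  ∑-cong (suc n) f≈g = +-cong (f≈g 0) (∑-cong n (f≈g ∘ suc))

  *-distribˡ-∑ : ∀ x n f → x * ∑ n f ≈ ∑ n (λ k → x * f k)
  *-distribˡ-∑ x zero    f = zeroʳ x
  *-distribˡ-∑ x (suc n) f = trans (distribˡ x _ _) (+-congˡ (*-distribˡ-∑ x n (f ∘ suc)))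

  P≡∑ : ∀ k x y → P R k x y ≡ ∑ k (λ j → x ^ (k ∸ 1 ∸ j) * y ^ j)
  P≡∑ k x y = ≡.cong (foldr _+_ 0#) (map-upTo _ k)

  Q≡∑ : ∀ k x y → Q R k x y ≡ ∑ k (λ j → (- 1#) ^ j * (x ^ (k ∸ 1 ∸ j) * y ^ j))
  Q≡∑ k x y = ≡.cong (foldr _+_ 0#) (map-upTo _ k)

  P-suc : ∀ k x y → P R (suc k) x y ≈ x ^ k + y * P R k x y
  P-suc k x y = begin
    P R (suc k) x y
      ≡⟨ P≡∑ (suc k) x y ⟩
    x ^ k * 1# + ∑ k (λ j → x ^ (k ∸ suc j) * (y * y ^ j))
      ≈⟨ +-cong (*-identityʳ _) (∑-cong k shift) ⟩
    x ^ k + ∑ k (λ j → y * (x ^ (k ∸ 1 ∸ j) * y ^ j))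
      ≈⟨ +-congˡ (*-distribˡ-∑ y k _) ⟨
    x ^ k + y * ∑ k (λ j → x ^ (k ∸ 1 ∸ j) * y ^ j)
      ≡⟨ ≡.cong (λ t → x ^ k + y * t) (P≡∑ k x y) ⟨
    x ^ k + y * P R k x y ∎
    where
    shift : ∀ j → x ^ (k ∸ suc j) * (y * y ^ j) ≈ y * (x ^ (k ∸ 1 ∸ j) * y ^ j)
    shift j rewrite ℕ.∸-+-assoc k 1 j =
      solve 3 (λ u y v → u :* (y :* v) := y :* (u :* v)) refl (x ^ (k ∸ suc j)) y (y ^ j)

  P-recurrence : ∀ k x y → P R (2 ℕ.+ k) x y ≈ (x + y) * P R (suc k) x y - (x * y) * P R k x y
  P-recurrence k x y = begin
    P R (2 ℕ.+ k) x y
      ≈⟨ P-suc (suc k) x y ⟩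
    x * x ^ k + y * P R (suc k) x y
      ≈⟨ solve 5 (λ x y u A B → x :* u :+ y :* A := x :* (u :+ y :* B) :+ y :* A :- (x :* y) :* B)
           refl x y (x ^ k) (P R (suc k) x y) (P R k x y) ⟩
    x * (x ^ k + y * P R k x y) + y * P R (suc k) x y - (x * y) * P R k x y
      ≈⟨ +-congʳ (+-congʳ (*-congˡ (P-suc k x y))) ⟨
    x * P R (suc k) x y + y * P R (suc k) x y - (x * y) * P R k x y
      ≈⟨ +-congʳ (distribʳ _ x y) ⟨
    (x + y) * P R (suc k) x y - (x * y) * P R k x y ∎

  P≈lucasU : ∀ k x y → P R k x y ≈ lucasU (x + y) (x * y) k
  P≈lucasU zero          x y = refl
  P≈lucasU (suc zero)    x y = trans (+-identityʳ _) (*-identityʳ 1#)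
  P≈lucasU (suc (suc k)) x y = trans (P-recurrence k x y)
    (+-cong (*-congˡ (P≈lucasU (suc k) x y)) (-‿cong (*-congˡ (P≈lucasU k x y))))

  [x-y]*P≈x^k-y^k : ∀ k x y → (x - y) * P R k x y ≈ x ^ k - y ^ k
  [x-y]*P≈x^k-y^k zero    x y =
    solve 2 (λ x y → (x :- y) :* con (+ 0) := con (+ 1) :- con (+ 1)) refl x y
  [x-y]*P≈x^k-y^k (suc k) x y = begin
    (x - y) * P R (suc k) x y
      ≈⟨ *-congˡ (P-suc k x y) ⟩
    (x - y) * (x ^ k + y * P R k x y)
      ≈⟨ solve 4 (λ x y u B → (x :- y) :* (u :+ y :* B) := (x :- y) :* u :+ y :* ((x :- y) :* B))
           refl x y (x ^ k) (P R k x y) ⟩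
    (x - y) * x ^ k + y * ((x - y) * P R k x y)
      ≈⟨ +-congˡ (*-congˡ ([x-y]*P≈x^k-y^k k x y)) ⟩
    (x - y) * x ^ k + y * (x ^ k - y ^ k)
      ≈⟨ solve 4 (λ x y u v → (x :- y) :* u :+ y :* (u :- v) := x :* u :- y :* v)
           refl x y (x ^ k) (y ^ k) ⟩
    x ^ suc k - y ^ suc k ∎

  Q≈P[x,-y] : ∀ k x y → Q R k x y ≈ P R k x (- y)
  Q≈P[x,-y] k x y = begin
    Q R k x y                                           ≡⟨ Q≡∑ k x y ⟩
    ∑ k (λ j → (- 1#) ^ j * (x ^ (k ∸ 1 ∸ j) * y ^ j))  ≈⟨ ∑-cong k sign-into-y ⟩
    ∑ k (λ j → x ^ (k ∸ 1 ∸ j) * (- y) ^ j)             ≡⟨ P≡∑ k x (- y) ⟨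
    P R k x (- y)                                       ∎
    where
    sign-into-y : ∀ j → (- 1#) ^ j * (x ^ (k ∸ 1 ∸ j) * y ^ j) ≈ x ^ (k ∸ 1 ∸ j) * (- y) ^ j
    sign-into-y j = begin
      (- 1#) ^ j * (x ^ (k ∸ 1 ∸ j) * y ^ j)
        ≈⟨ solve 3 (λ s u v → s :* (u :* v) := u :* (s :* v)) refl _ _ _ ⟩
      x ^ (k ∸ 1 ∸ j) * ((- 1#) ^ j * y ^ j)
        ≈⟨ *-congˡ (^-distrib-* (- 1#) y j) ⟨
      x ^ (k ∸ 1 ∸ j) * (- 1# * y) ^ j
        ≈⟨ *-congˡ (^-congˡ j (-1*x≈-x y)) ⟩
      x ^ (k ∸ 1 ∸ j) * (- y) ^ j ∎

  [-x]^odd≈-x^odd : ∀ x i → (- x) ^ suc (i ℕ.* 2) ≈ - (x ^ suc (i ℕ.* 2))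
  [-x]^odd≈-x^odd x zero    = solve 1 (λ x → :- x :* con (+ 1) := :- (x :* con (+ 1))) refl x
  [-x]^odd≈-x^odd x (suc i) = trans (*-congˡ (*-congˡ ([-x]^odd≈-x^odd x i)))
    (solve 2 (λ x u → :- x :* (:- x :* :- u) := :- (x :* (x :* u))) refl x (x ^ suc (i ℕ.* 2)))

  [x+y]*Q≈x^n+y^n : ∀ i x y → let n = suc (i ℕ.* 2) in (x + y) * Q R n x y ≈ x ^ n + y ^ n
  [x+y]*Q≈x^n+y^n i x y = begin
    (x + y) * Q R n x y         ≈⟨ *-cong (+-congˡ (-‿involutive y)) (sym (Q≈P[x,-y] n x y)) ⟨
    (x - - y) * P R n x (- y)   ≈⟨ [x-y]*P≈x^k-y^k n x (- y) ⟩
    x ^ n - (- y) ^ n           ≈⟨ +-congˡ (-‿cong ([-x]^odd≈-x^odd y i)) ⟩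
    x ^ n - - (y ^ n)           ≈⟨ +-congˡ (-‿involutive (y ^ n)) ⟩
    x ^ n + y ^ n               ∎
    where
    n : ℕ
    n = suc (i ℕ.* 2)

module LucasOddImage {c ℓ c′ ℓ′} (D : CommutativeRing c ℓ) (R : CommutativeRing c′ ℓ′)
  {ι : CommutativeRing.Carrier D → CommutativeRing.Carrier R}
  (ι-homo : RingMorphisms.IsRingHomomorphism (CommutativeRing.rawRing D)
                                             (CommutativeRing.rawRing R) ι) where
  private
    module D = CommutativeRing D
    module DL = LucasSequences D
    module RL = LucasSequences R
  open CommutativeRing R
  open RawSemiring (RawRing.rawSemiring rawRing) using (_^_)
  open RawSemiring (RawRing.rawSemiring D.rawRing) using () renaming (_^_ to _^ᴰ_)
  open RingMorphisms.IsRingHomomorphism ι-homo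
  open import Relation.Binary.Reasoning.Setoid setoid

  sub-homo : ∀ x y → ι (x D.- y) ≈ ι x - ι y
  sub-homo x y = trans (+-homo x (D.- y)) (+-congˡ (-‿homo y))

  ^-homo : ∀ x k → ι (x ^ᴰ k) ≈ ι x ^ k
  ^-homo x zero    = 1#-homo
  ^-homo x (suc k) = trans (*-homo x (x ^ᴰ k)) (*-congˡ (^-homo x k))

  lucasOdd-homo : ∀ {σ π σ′ π′} → ι σ ≈ σ′ → ι π ≈ π′ →
                  ∀ i → ι (DL.lucasOdd σ π i) ≈ RL.lucasOdd σ′ π′ i
  lucasOdd-homo _ _ zero = 1#-homo
  lucasOdd-homo {σ} {π} ισ≈σ′ ιπ≈π′ (suc zero) =
    trans (sub-homo σ π) (+-cong ισ≈σ′ (-‿cong ιπ≈π′))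
  lucasOdd-homo {σ} {π} {σ′} {π′} ισ≈σ′ ιπ≈π′ (suc (suc i)) = begin
    ι ((σ D.- (π D.+ π)) D.* DL.lucasOdd σ π (suc i) D.- (π D.* π) D.* DL.lucasOdd σ π i)
      ≈⟨ sub-homo _ _ ⟩
    ι ((σ D.- (π D.+ π)) D.* DL.lucasOdd σ π (suc i)) - ι ((π D.* π) D.* DL.lucasOdd σ π i)
      ≈⟨ +-cong (*-homo _ _) (-‿cong (*-homo _ _)) ⟩
    ι (σ D.- (π D.+ π)) * ι (DL.lucasOdd σ π (suc i)) - ι (π D.* π) * ι (DL.lucasOdd σ π i)
      ≈⟨ +-cong (*-cong ισ-2π (lucasOdd-homo ισ≈σ′ ιπ≈π′ (suc i)))
                (-‿cong (*-cong ιπ² (lucasOdd-homo ισ≈σ′ ιπ≈π′ i))) ⟩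
    _ ∎
    where
    ισ-2π : ι (σ D.- (π D.+ π)) ≈ σ′ - (π′ + π′)
    ισ-2π = trans (sub-homo σ (π D.+ π))
      (+-cong ισ≈σ′ (-‿cong (trans (+-homo π π) (+-cong ιπ≈π′ ιπ≈π′))))
    ιπ² : ι (π D.* π) ≈ π′ * π′
    ιπ² = trans (*-homo π π) (*-cong ιπ≈π′ ιπ≈π′)

  lucasOdd-image : ∀ {σ π x y} → ι σ ≈ (x + y) ^ 2 → ι π ≈ x * y →
                   ∀ i → ι (DL.lucasOdd σ π i) ≈ P R (suc (i ℕ.* 2)) x y
  lucasOdd-image {x = x} {y} ισ ιπ i = begin
    ι (DL.lucasOdd _ _ i)                        ≈⟨ lucasOdd-homo ισ ιπ i ⟩
    RL.lucasOdd ((x + y) ^ 2) (x * y) i          ≈⟨ RL.lucasU-odd (x + y) (x * y) i ⟨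
    RL.lucasU (x + y) (x * y) (suc (i ℕ.* 2))    ≈⟨ GeometricSums.P≈lucasU R (suc (i ℕ.* 2)) x y ⟨
    P R (suc (i ℕ.* 2)) x y                      ∎

-- Witnesses are indexed by j with n = 2j + 1 and by i with m = 2i + 1.
module Witnesses {c ℓ c′ ℓ′} (D : CommutativeRing c ℓ) (R : CommutativeRing c′ ℓ′)
  {ι : CommutativeRing.Carrier D → CommutativeRing.Carrier R}
  (ι-homo : RingMorphisms.IsRingHomomorphism (CommutativeRing.rawRing D)
                                             (CommutativeRing.rawRing R) ι)
  (a b : CommutativeRing.Carrier R) (s p : CommutativeRing.Carrier D)
  (ιs≈[a+b]² : CommutativeRing._≈_ R (ι s) (pow R (CommutativeRing._+_ R a b) 2))
  (ιp≈ab : CommutativeRing._≈_ R (ι p) (CommutativeRing._*_ R a b)) where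
  private
    module D = CommutativeRing D
  open CommutativeRing R
  open RawSemiring (RawRing.rawSemiring rawRing) using (_^_)
  open RawSemiring (RawRing.rawSemiring D.rawRing) using (_∣_) renaming (_^_ to _^ᴰ_)
  open import Algebra.Properties.Semiring.Exp semiring using (^-congˡ)
  open import Algebra.Properties.CommutativeSemiring.Exp commutativeSemiring using (^-distrib-*)
  open import Algebra.Properties.Semigroup.Divisibility D.*-semigroup using (x∣ʳy⇒x∣ʳzy)
  open import Algebra.Properties.Magma.Divisibility D.*-magma using (∣ʳ-respʳ-≈)
  open import Relation.Binary.Reasoning.Setoid setoid
  open RingMorphisms.IsRingHomomorphism ι-homo
  open LucasSequences D using (lucasOdd)
  open LucasOddDivisibility D
  open LucasOddImage D R ι-homo
  open GeometricSums R using (Q≈P[x,-y]; [x+y]*Q≈x^n+y^n)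
  open IntegerCoefficientSolver R
  open Congruence D using (∣-+; ∣‿-; Prime⇒∣^⇒∣)
  open import Algebra.Properties.Ring D.ring using (//-rightDividesˡ)

  4p : D.Carrier
  4p = (p D.+ p) D.+ (p D.+ p)

  Qᴰ : ℕ → D.Carrier
  Qᴰ j = lucasOdd (s D.- 4p) (D.- p) j

  Pᴰ : ℕ → ℕ → D.Carrier
  Pᴰ i j = lucasOdd (s D.* (Qᴰ j D.* Qᴰ j)) (p ^ᴰ suc (j ℕ.* 2)) i

  ιQᴰ≈Q : ∀ j → ι (Qᴰ j) ≈ Q R (suc (j ℕ.* 2)) a b
  ιQᴰ≈Q j = trans (lucasOdd-image ι[s-4p] ι[-p] j) (sym (Q≈P[x,-y] (suc (j ℕ.* 2)) a b))
    where
    ι[s-4p] : ι (s D.- 4p) ≈ (a + - b) ^ 2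
    ι[s-4p] = begin
      ι (s D.- 4p)                               ≈⟨ sub-homo s 4p ⟩
      ι s - ι 4p                                 ≈⟨ +-congˡ (-‿cong (trans (+-homo _ _)
                                                      (+-cong (+-homo p p) (+-homo p p)))) ⟩
      ι s - ((ι p + ι p) + (ι p + ι p))          ≈⟨ +-cong ιs≈[a+b]² (-‿cong (+-cong
                                                      (+-cong ιp≈ab ιp≈ab) (+-cong ιp≈ab ιp≈ab))) ⟩
      (a + b) ^ 2 - ((a * b + a * b) + (a * b + a * b))
        ≈⟨ solve 2 (λ a b → (a :+ b) :^ 2 :- ((a :* b :+ a :* b) :+ (a :* b :+ a :* b))
                             := (a :+ :- b) :^ 2) refl a b ⟩
      (a + - b) ^ 2                              ∎
    ι[-p] : ι (D.- p) ≈ a * - b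
    ι[-p] = trans (-‿homo p)
      (trans (-‿cong ιp≈ab) (solve 2 (λ a b → :- (a :* b) := a :* :- b) refl a b))

  ιPᴰ≈P : ∀ i j → let n = suc (j ℕ.* 2) in ι (Pᴰ i j) ≈ P R (suc (i ℕ.* 2)) (a ^ n) (b ^ n)
  ιPᴰ≈P i j = lucasOdd-image ι[sQ²] ι[pⁿ] i
    where
    n : ℕ
    n = suc (j ℕ.* 2)
    ι[sQ²] : ι (s D.* (Qᴰ j D.* Qᴰ j)) ≈ (a ^ n + b ^ n) ^ 2
    ι[sQ²] = begin
      ι (s D.* (Qᴰ j D.* Qᴰ j))
        ≈⟨ trans (*-homo _ _) (*-congˡ (*-homo _ _)) ⟩
      ι s * (ι (Qᴰ j) * ι (Qᴰ j))
        ≈⟨ *-cong ιs≈[a+b]² (*-cong (ιQᴰ≈Q j) (ιQᴰ≈Q j)) ⟩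
      (a + b) ^ 2 * (Q R n a b * Q R n a b)
        ≈⟨ solve 2 (λ t u → t :^ 2 :* (u :* u) := (t :* u) :^ 2) refl (a + b) (Q R n a b) ⟩
      ((a + b) * Q R n a b) ^ 2
        ≈⟨ ^-congˡ 2 ([x+y]*Q≈x^n+y^n j a b) ⟩
      (a ^ n + b ^ n) ^ 2 ∎
    ι[pⁿ] : ι (p ^ᴰ n) ≈ a ^ n * b ^ n
    ι[pⁿ] = trans (^-homo p n) (trans (^-congˡ n ιp≈ab) (^-distrib-* a b n))

  Pᴰ-Qᴰ-coprime : CoprimeElts D s p → ∀ i j → CoprimeElts D (Pᴰ i j) (Qᴰ j)
  Pᴰ-Qᴰ-coprime s⊥p i j q q-prime q∣P q∣Q = s⊥p q q-prime q∣s q∣p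
    where
    q∣p : q ∣ p
    q∣p = Prime⇒∣^⇒∣ q-prime p (suc (j ℕ.* 2))
      (Prime∧∣σ∧∣lucasOdd⇒∣π q-prime (x∣ʳy⇒x∣ʳzy s (x∣ʳy⇒x∣ʳzy (Qᴰ j) q∣Q)) i q∣P)
    q∣s : q ∣ s
    q∣s = ∣ʳ-respʳ-≈ (//-rightDividesˡ 4p s)
      (∣-+ (Prime∧∣π∧∣lucasOdd⇒∣σ q-prime (∣‿- q∣p) j q∣Q) (∣-+ (∣-+ q∣p q∣p) (∣-+ q∣p q∣p)))

m%2≡1⇒m≡1+i*2 : ∀ m → m % 2 ≡ 1 → Σ ℕ λ i → m ≡ suc (i ℕ.* 2)
m%2≡1⇒m≡1+i*2 m m%2≡1 = m / 2 , ≡.trans (m≡m%n+[m/n]*n m 2) (≡.cong (ℕ._+ m / 2 ℕ.* 2) m%2≡1)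

lemma2p7 : ∀ {c ℓ c' ℓ' : Level} (D : CommutativeRing c ℓ) (R : CommutativeRing c' ℓ') →
    IsUFD D → IsIntegralDomain R →
    (ι : CommutativeRing.Carrier D → CommutativeRing.Carrier R) → IsRingMonomorphism D R ι →
    (a b : CommutativeRing.Carrier R) → IsAlgebraic D R ι a → IsAlgebraic D R ι b →
    (s p : CommutativeRing.Carrier D) →
    CommutativeRing._≈_ R (ι s) (pow R (CommutativeRing._+_ R a b) 2) →
    CommutativeRing._≈_ R (ι p) (CommutativeRing._*_ R a b) →
    CoprimeElts D s p →
    (m n : ℕ) → 0 < m → m % 2 ≡ 1 → 0 < n → n % 2 ≡ 1 →
    Σ (CommutativeRing.Carrier D) λ x → Σ (CommutativeRing.Carrier D) λ y →
    CommutativeRing._≈_ R (ι x) (P R m (pow R a n) (pow R b n)) ×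
    CommutativeRing._≈_ R (ι y) (Q R n a b) ×
    CoprimeElts D x y
lemma2p7 D R _ _ _ ι-mono a b _ _ s p ιs≈[a+b]² ιp≈ab s⊥p m n _ m%2≡1 _ n%2≡1
  with m%2≡1⇒m≡1+i*2 m m%2≡1 | m%2≡1⇒m≡1+i*2 n n%2≡1
... | i , ≡.refl | j , ≡.refl =
  Pᴰ i j , Qᴰ j , ιPᴰ≈P i j , ιQᴰ≈Q j , Pᴰ-Qᴰ-coprime s⊥p i j
  where
  open Witnesses D R (RingMorphisms.IsRingMonomorphism.isRingHomomorphism ι-mono)
    a b s p ιs≈[a+b]² ιp≈ab
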